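{- Let $b\in\mathbb{Z}$, $c\in\mathbb{Z}\setminus\{0\}$ and $n$ a positive integer, and for $k\in\mathbb{N}$ let $T_k(b,c)=\sum_{j=0}^{\lfloor k/2\rfloor}\binom k{2j}\binom{2j}j b^{k-2j}c^j$. Then $$\frac3n\sum_{k=0}^{n-1}kT_k(b,c^2)(b-2c)^{n-1-k}-\sum_{k=0}^{n-1}T_k(b,c^2)(b-2c)^{n-1-k}=\frac{(b+4c)T_n(b,c^2)-(b+2c)^2T_{n-1}(b,c^2)}{4c^2}.$$ -}

module Defs where

open import Data.Nat as ℕ using (ℕ; zero; suc; _/_)
open import Data.Nat.Combinatorics using (_C_)
open import Data.Integer as ℤ using (ℤ; +_; _+_; _-_; _*_; _^_)
open import Data.Rational as ℚ using (ℚ)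

sumℤ : ℕ → (ℕ → ℤ) → ℤ
sumℤ zero    f = + 0
sumℤ (suc m) f = sumℤ m f + f m

sumℚ : ℕ → (ℕ → ℚ) → ℚ
sumℚ zero    f = ℚ.0ℚ
sumℚ (suc m) f = sumℚ m f ℚ.+ f m

T : ℕ → ℤ → ℤ → ℤ
T k b c = sumℤ (suc (k / 2)) λ j →
  + ((k C (2 ℕ.* j)) ℕ.* ((2 ℕ.* j) C j)) * (b ^ (k ℕ.∸ 2 ℕ.* j)) * (c ^ j)

⟦_⟧ : ℤ → ℚ
⟦ z ⟧ = ℚ._/_ z 1

open import Data.Nat.Properties as ℕP using (m*n≢0)

-- x / (4 c²)  for an integer numerator x and nonzero integer c
-- (the denominator 4c² = 4·|c|·|c| is a positive natural number)
_/4c²[_] : ℤ → (c : ℤ) → .{{ℤ.NonZero c}} → ℚ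
x /4c²[ c ] = ℚ._/_ x (4 ℕ.* ℤ.∣ c ∣ ℕ.* ℤ.∣ c ∣) {{m*n≢0 (4 ℕ.* ℤ.∣ c ∣) ℤ.∣ c ∣ {{m*n≢0 4 ℤ.∣ c ∣}}}}

module Submission where

-- Proof outline.
-- (1) The coefficients a(k,j) = C(k,2j) C(2j,j) of T_k satisfy a three-term recurrence in k
--     (coeff-rec), obtained from Pascal's rule and absorption by comparing a(·,j+1) with a(·,j).
--     Multiplying by b^(k-2j) c^j and summing over j gives
--       (n+1) T_{n+1} + n (b² - 4c) T_{n-1} = (2n+1) b T_n                     (T-rec).
-- (2) Both sums are Horner sums S(n) = Σ_{k<n} f(k) d^(n-1-k), so S(n+1) = d S(n) + f(n).
--     For the parameter c² the discriminant is b² - 4c² = (b - 2c)(b + 2c), and induction on n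
--     with T-rec gives the closed form  2c (b-2c) S₀(n) = ((n+1) b + 2nc) t_n - (n+1) t_{n+1}
--     (S₀-closed) and then the integer identity  4c² (3 S₁(n) - n S₀(n)) = n G(n), where G(n)
--     is the numerator on the right (scaled-identity).
-- (3) The embedding ℤ → ℚ commutes with sums, and clearing denominators turns the integer
--     identity into the theorem (scaled-difference).

open import Defs
open import Data.Nat as ℕ using (ℕ; zero; suc; _≤_; _<_; s≤s; _∸_)
import Data.Nat.Properties as ℕP
open import Data.Nat.DivMod using (m≡m%n+[m/n]*n; m%n<n; m/n≤m)
open import Data.Nat.Combinatorics using (_C_; nCk+nC[k+1]≡[n+1]C[k+1]; k>n⇒nCk≡0; nC1≡n)
open import Data.Integer as ℤ using (ℤ; +_; _+_; _-_; _*_; _^_)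
import Data.Integer.Properties as ℤP
open import Data.Integer.Tactic.RingSolver using (solve-∀)
open import Data.Rational as ℚ using ()
import Data.Rational.Properties as ℚP
open import Data.Rational.Unnormalised as ℚᵘ using (mkℚᵘ; *≡*)
import Data.Rational.Unnormalised.Properties as ℚᵘP
open import Relation.Binary.PropositionalEquality
open import Relation.Nullary using (yes; no)

binom : ℕ → ℕ → ℤ
binom m k = + (m C k)

binom-pascal : ∀ m k → binom m k + binom m (suc k) ≡ binom (suc m) (suc k)
binom-pascal m k = cong +_ (nCk+nC[k+1]≡[n+1]C[k+1] m k)

binom-absorb : ∀ m k → + suc k * binom (suc m) (suc k) ≡ + suc m * binom m k
binom-absorb zero    zero    = refl
binom-absorb zero    (suc k) = ℤP.*-zeroʳ (+ suc (suc k))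
binom-absorb (suc m) zero    = begin
  + 1 * binom (suc (suc m)) 1  ≡⟨ ℤP.*-identityˡ _ ⟩
  + (suc (suc m) C 1)          ≡⟨ cong +_ (nC1≡n (suc (suc m))) ⟩
  + suc (suc m)                ≡⟨ ℤP.*-identityʳ _ ⟨
  + suc (suc m) * + 1          ∎
  where open ≡-Reasoning
binom-absorb (suc m) (suc k) = begin
  + suc (suc k) * binom (suc (suc m)) (suc (suc k))
    ≡⟨ cong (+ suc (suc k) *_) (binom-pascal (suc m) (suc k)) ⟨
  + suc (suc k) * (x + y)
    ≡⟨ split (+ k) x y ⟩
  + suc k * x + x + + suc (suc k) * y
    ≡⟨ cong₂ (λ u v → u + x + v) (binom-absorb m k) (binom-absorb m (suc k)) ⟩
  + suc m * binom m k + x + + suc m * binom m (suc k)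
    ≡⟨ regroup (+ m) (binom m k) x (binom m (suc k)) ⟩
  + suc m * (binom m k + binom m (suc k)) + x
    ≡⟨ cong (λ u → + suc m * u + x) (binom-pascal m k) ⟩
  + suc m * x + x
    ≡⟨ merge (+ m) x ⟩
  + suc (suc m) * x ∎
  where
  open ≡-Reasoning
  x = binom (suc m) (suc k)
  y = binom (suc m) (suc (suc k))
  split : ∀ k x y → (+ 2 + k) * (x + y) ≡ (+ 1 + k) * x + x + (+ 2 + k) * y
  split = solve-∀
  regroup : ∀ m p x q → (+ 1 + m) * p + x + (+ 1 + m) * q ≡ (+ 1 + m) * (p + q) + x
  regroup = solve-∀
  merge : ∀ m x → (+ 1 + m) * x + x ≡ (+ 2 + m) * x
  merge = solve-∀

-- (k+1) C(m,k+1) = (m-k) C(m,k); in ℤ this holds for all m and k.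
binom-step : ∀ m k → + suc k * binom m (suc k) ≡ (+ m - + k) * binom m k
binom-step m k = begin
  + suc k * binom m (suc k)
    ≡⟨ isolate (+ k) (binom m k) (binom m (suc k)) ⟩
  + suc k * (binom m k + binom m (suc k)) - + suc k * binom m k
    ≡⟨ cong (λ u → + suc k * u - + suc k * binom m k) (binom-pascal m k) ⟩
  + suc k * binom (suc m) (suc k) - + suc k * binom m k
    ≡⟨ cong (_- + suc k * binom m k) (binom-absorb m k) ⟩
  + suc m * binom m k - + suc k * binom m k
    ≡⟨ factor (+ m) (+ k) (binom m k) ⟩
  (+ m - + k) * binom m k ∎
  where
  open ≡-Reasoning
  isolate : ∀ k p q → (+ 1 + k) * q ≡ (+ 1 + k) * (p + q) - (+ 1 + k) * p
  isolate = solve-∀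
  factor : ∀ m k p → (+ 1 + m) * p - (+ 1 + k) * p ≡ (m - k) * p
  factor = solve-∀

binom-drop : ∀ m k → (+ suc m - + k) * binom (suc m) k ≡ + suc m * binom m k
binom-drop m k = trans (sym (binom-step (suc m) k)) (binom-absorb m k)

binom-central : ∀ i → let E = 2 ℕ.* i in
  + suc i * (+ suc i * binom (suc (suc E)) (suc i)) ≡ + suc (suc E) * (+ suc E * binom E i)
binom-central i = begin
  + suc i * (+ suc i * binom (suc (suc E)) (suc i))
    ≡⟨ cong (+ suc i *_) (binom-absorb (suc E) i) ⟩
  + suc i * (+ suc (suc E) * binom (suc E) i)
    ≡⟨ swap (+ suc i) (+ suc (suc E)) (binom (suc E) i) ⟩
  + suc (suc E) * (+ suc i * binom (suc E) i)
    ≡⟨ cong (λ u → + suc (suc E) * (u * binom (suc E) i)) suc-i ⟩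
  + suc (suc E) * ((+ suc E - + i) * binom (suc E) i)
    ≡⟨ cong (+ suc (suc E) *_) (binom-drop E i) ⟩
  + suc (suc E) * (+ suc E * binom E i) ∎
  where
  open ≡-Reasoning
  E = 2 ℕ.* i
  swap : ∀ p q x → p * (q * x) ≡ q * (p * x)
  swap = solve-∀
  suc-i : + suc i ≡ + suc E - + i
  suc-i = begin
    + suc i                 ≡⟨ cancel (+ i) ⟩
    + 1 + (+ 2 * + i) - + i ≡⟨ cong (λ u → + 1 + u - + i) (ℤP.pos-* 2 i) ⟨
    + suc E - + i           ∎
    where cancel : ∀ i → + 1 + i ≡ + 1 + (+ 2 * i) - i
          cancel = solve-∀

coeff : ℕ → ℕ → ℤ
coeff k j = + ((k C (2 ℕ.* j)) ℕ.* ((2 ℕ.* j) C j))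

coeff-split : ∀ k j → coeff k j ≡ binom k (2 ℕ.* j) * binom (2 ℕ.* j) j
coeff-split k j = ℤP.pos-* (k C (2 ℕ.* j)) ((2 ℕ.* j) C j)

coeff-suc : ∀ m i → let E = 2 ℕ.* i in
  coeff m (suc i) ≡ binom m (suc (suc E)) * binom (suc (suc E)) (suc i)
coeff-suc m i = trans (cong (λ e → + ((m C e) ℕ.* (e C suc i))) (ℕP.*-suc 2 i))
                      (ℤP.pos-* (m C suc (suc E)) (suc (suc E) C suc i))
  where E = 2 ℕ.* i

coeff-raise : ∀ m i → let E = 2 ℕ.* i in
  + suc i * (+ suc i * coeff m (suc i)) ≡ (+ m - + suc E) * ((+ m - + E) * coeff m i)
coeff-raise m i = begin
  s * (s * coeff m (suc i))              ≡⟨ cong (λ u → s * (s * u)) (coeff-suc m i) ⟩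
  s * (s * (P * Q))                      ≡⟨ pull s P Q ⟩
  P * (s * (s * Q))                      ≡⟨ cong (P *_) (binom-central i) ⟩
  P * (+ suc (suc E) * (+ suc E * Y))    ≡⟨ regroup P (+ suc (suc E)) (+ suc E) Y ⟩
  (+ suc (suc E) * P) * (+ suc E * Y)    ≡⟨ cong (_* (+ suc E * Y)) (binom-step m (suc E)) ⟩
  ((+ m - + suc E) * R) * (+ suc E * Y)  ≡⟨ regroup′ (+ m - + suc E) R (+ suc E) Y ⟩
  (+ m - + suc E) * ((+ suc E * R) * Y)  ≡⟨ cong (λ u → (+ m - + suc E) * (u * Y)) (binom-step m E) ⟩
  (+ m - + suc E) * (((+ m - + E) * binom m E) * Y)
    ≡⟨ cong ((+ m - + suc E) *_) (ℤP.*-assoc (+ m - + E) (binom m E) Y) ⟩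
  (+ m - + suc E) * ((+ m - + E) * (binom m E * Y))
    ≡⟨ cong (λ u → (+ m - + suc E) * ((+ m - + E) * u)) (coeff-split m i) ⟨
  (+ m - + suc E) * ((+ m - + E) * coeff m i) ∎
  where
  open ≡-Reasoning
  E = 2 ℕ.* i
  s = + suc i
  P = binom m (suc (suc E))
  Q = binom (suc (suc E)) (suc i)
  R = binom m (suc E)
  Y = binom E i
  pull : ∀ s p q → s * (s * (p * q)) ≡ p * (s * (s * q))
  pull = solve-∀
  regroup : ∀ p x y z → p * (x * (y * z)) ≡ (x * p) * (y * z)
  regroup = solve-∀
  regroup′ : ∀ x r y z → (x * r) * (y * z) ≡ x * ((y * r) * z)
  regroup′ = solve-∀

coeff-drop : ∀ m i → (+ suc m - + (2 ℕ.* i)) * coeff (suc m) i ≡ + suc m * coeff m i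
coeff-drop m i = begin
  t * coeff (suc m) i                          ≡⟨ cong (t *_) (coeff-split (suc m) i) ⟩
  t * (binom (suc m) E * Y)                    ≡⟨ ℤP.*-assoc t (binom (suc m) E) Y ⟨
  (t * binom (suc m) E) * Y                    ≡⟨ cong (_* Y) (binom-drop m E) ⟩
  (+ suc m * binom m E) * Y                    ≡⟨ ℤP.*-assoc (+ suc m) (binom m E) Y ⟩
  + suc m * (binom m E * Y)                    ≡⟨ cong (+ suc m *_) (coeff-split m i) ⟨
  + suc m * coeff m i                          ∎
  where
  open ≡-Reasoning
  E = 2 ℕ.* i
  t = + suc m - + E
  Y = binom E i

coeff-raise₁ : ∀ m i → let E = 2 ℕ.* i in
  + suc i * (+ suc i * coeff (suc m) (suc i)) ≡ + suc m * ((+ m - + E) * coeff m i)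
coeff-raise₁ m i = begin
  + suc i * (+ suc i * coeff (suc m) (suc i))
    ≡⟨ coeff-raise (suc m) i ⟩
  (+ suc m - + suc E) * ((+ suc m - + E) * coeff (suc m) i)
    ≡⟨ cong ((+ suc m - + suc E) *_) (coeff-drop m i) ⟩
  (+ suc m - + suc E) * (+ suc m * coeff m i)
    ≡⟨ reorder (+ m) (+ E) (coeff m i) ⟩
  + suc m * ((+ m - + E) * coeff m i) ∎
  where
  open ≡-Reasoning
  E = 2 ℕ.* i
  reorder : ∀ m e x → (+ 1 + m - (+ 1 + e)) * ((+ 1 + m) * x) ≡ (+ 1 + m) * ((m - e) * x)
  reorder = solve-∀

coeff-raise₂ : ∀ m i →
  + suc i * (+ suc i * coeff (suc (suc m)) (suc i)) ≡ + suc (suc m) * (+ suc m * coeff m i)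
coeff-raise₂ m i = begin
  + suc i * (+ suc i * coeff (suc (suc m)) (suc i))
    ≡⟨ coeff-raise (suc (suc m)) i ⟩
  (+ suc (suc m) - + suc E) * ((+ suc (suc m) - + E) * coeff (suc (suc m)) i)
    ≡⟨ cong ((+ suc (suc m) - + suc E) *_) (coeff-drop (suc m) i) ⟩
  (+ suc (suc m) - + suc E) * (+ suc (suc m) * coeff (suc m) i)
    ≡⟨ reorder (+ m) (+ E) (coeff (suc m) i) ⟩
  + suc (suc m) * ((+ suc m - + E) * coeff (suc m) i)
    ≡⟨ cong (+ suc (suc m) *_) (coeff-drop m i) ⟩
  + suc (suc m) * (+ suc m * coeff m i) ∎
  where
  open ≡-Reasoning
  E = 2 ℕ.* i
  reorder : ∀ m e x → (+ 2 + m - (+ 1 + e)) * ((+ 2 + m) * x) ≡ (+ 2 + m) * ((+ 1 + m - e) * x)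
  reorder = solve-∀

-- The coefficient a(m,j-1) (zero for j = 0), which multiplies c^j in c·T_m.
coeff-pred : ℕ → ℕ → ℤ
coeff-pred m zero    = + 0
coeff-pred m (suc i) = coeff m i

coeff-rec : ∀ m j →
  (+ 2 + + m) * coeff (2 ℕ.+ m) j + (+ 1 + + m) * coeff m j
    ≡ (+ 3 + + 2 * + m) * coeff (1 ℕ.+ m) j + + 4 * (+ 1 + + m) * coeff-pred m j
coeff-rec m zero    = constant (+ m)
  where
  constant : ∀ m → (+ 2 + m) * + 1 + (+ 1 + m) * + 1 ≡ (+ 3 + + 2 * m) * + 1 + + 4 * (+ 1 + m) * + 0
  constant = solve-∀
coeff-rec m (suc i) = ℤP.*-cancelˡ-≡ s _ _ (ℤP.*-cancelˡ-≡ s _ _ (begin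
  s * (s * ((+ 2 + + m) * A₂ + (+ 1 + + m) * A₀))
    ≡⟨ distribute s (+ 2 + + m) (+ 1 + + m) A₂ A₀ ⟩
  (+ 2 + + m) * (s * (s * A₂)) + (+ 1 + + m) * (s * (s * A₀))
    ≡⟨ cong₂ (λ u v → (+ 2 + + m) * u + (+ 1 + + m) * v) (coeff-raise₂ m i) (coeff-raise m i) ⟩
  (+ 2 + + m) * (+ suc (suc m) * (+ suc m * X)) + (+ 1 + + m) * ((+ m - + suc E) * ((+ m - + E) * X))
    ≡⟨ polynomial ⟩
  (+ 3 + + 2 * + m) * (+ suc m * ((+ m - + E) * X)) + + 4 * (+ 1 + + m) * (s * (s * X))
    ≡⟨ cong (λ u → (+ 3 + + 2 * + m) * u + + 4 * (+ 1 + + m) * (s * (s * X))) (coeff-raise₁ m i) ⟨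
  (+ 3 + + 2 * + m) * (s * (s * A₁)) + + 4 * (+ 1 + + m) * (s * (s * X))
    ≡⟨ distribute s (+ 3 + + 2 * + m) (+ 4 * (+ 1 + + m)) A₁ X ⟨
  s * (s * ((+ 3 + + 2 * + m) * A₁ + + 4 * (+ 1 + + m) * X)) ∎))
  where
  open ≡-Reasoning
  E = 2 ℕ.* i
  s = + suc i
  A₂ = coeff (2 ℕ.+ m) (suc i)
  A₁ = coeff (1 ℕ.+ m) (suc i)
  A₀ = coeff m (suc i)
  X = coeff m i
  distribute : ∀ s p q x y → s * (s * (p * x + q * y)) ≡ p * (s * (s * x)) + q * (s * (s * y))
  distribute = solve-∀
  -- with w = m - 2i: (m+2)² + (w-1)w - (2m+3)w = (m+2-w)² = 4(i+1)²
  identity : ∀ m i X →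
    (+ 2 + m) * ((+ 2 + m) * ((+ 1 + m) * X)) + (+ 1 + m) * ((m - (+ 1 + + 2 * i)) * ((m - + 2 * i) * X))
      ≡ (+ 3 + + 2 * m) * ((+ 1 + m) * ((m - + 2 * i) * X)) + + 4 * (+ 1 + m) * ((+ 1 + i) * ((+ 1 + i) * X))
  identity = solve-∀
  polynomial : (+ 2 + + m) * (+ suc (suc m) * (+ suc m * X)) + (+ 1 + + m) * ((+ m - + suc E) * ((+ m - + E) * X))
             ≡ (+ 3 + + 2 * + m) * (+ suc m * ((+ m - + E) * X)) + + 4 * (+ 1 + + m) * (s * (s * X))
  polynomial = subst (λ e → (+ 2 + + m) * (+ suc (suc m) * (+ suc m * X)) + (+ 1 + + m) * ((+ m - (+ 1 + e)) * ((+ m - e) * X))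
                          ≡ (+ 3 + + 2 * + m) * (+ suc m * ((+ m - e) * X)) + + 4 * (+ 1 + + m) * (s * (s * X)))
                     (sym (ℤP.pos-* 2 i)) (identity (+ m) (+ i) X)

sum-cong : ∀ N {f g : ℕ → ℤ} → (∀ j → j < N → f j ≡ g j) → sumℤ N f ≡ sumℤ N g
sum-cong zero    eq = refl
sum-cong (suc N) eq = cong₂ _+_ (sum-cong N (λ j j<N → eq j (ℕP.m<n⇒m<1+n j<N))) (eq N ℕP.≤-refl)

sum-scale : ∀ N x (f : ℕ → ℤ) → x * sumℤ N f ≡ sumℤ N (λ j → x * f j)
sum-scale zero    x f = ℤP.*-zeroʳ x
sum-scale (suc N) x f = trans (ℤP.*-distribˡ-+ x (sumℤ N f) (f N)) (cong (_+ x * f N) (sum-scale N x f))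

sum-linear : ∀ N x y (f g : ℕ → ℤ) → x * sumℤ N f + y * sumℤ N g ≡ sumℤ N (λ j → x * f j + y * g j)
sum-linear zero    x y f g = cong₂ _+_ (ℤP.*-zeroʳ x) (ℤP.*-zeroʳ y)
sum-linear (suc N) x y f g = begin
  x * (sumℤ N f + f N) + y * (sumℤ N g + g N)
    ≡⟨ interchange x y (sumℤ N f) (f N) (sumℤ N g) (g N) ⟩
  (x * sumℤ N f + y * sumℤ N g) + (x * f N + y * g N)
    ≡⟨ cong (_+ (x * f N + y * g N)) (sum-linear N x y f g) ⟩
  sumℤ N (λ j → x * f j + y * g j) + (x * f N + y * g N) ∎
  where
  open ≡-Reasoning
  interchange : ∀ x y a b c d → x * (a + b) + y * (c + d) ≡ (x * a + y * c) + (x * b + y * d)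
  interchange = solve-∀

sum-shift : ∀ N (f : ℕ → ℤ) → sumℤ (suc N) f ≡ f 0 + sumℤ N (λ j → f (suc j))
sum-shift zero    f = ℤP.+-comm (+ 0) (f 0)
sum-shift (suc N) f = trans (cong (_+ f (suc N)) (sum-shift N f)) (ℤP.+-assoc (f 0) _ _)

sum-pad : ∀ d M (f : ℕ → ℤ) → (∀ j → M ≤ j → f j ≡ + 0) → sumℤ (d ℕ.+ M) f ≡ sumℤ M f
sum-pad zero    M f vanish = refl
sum-pad (suc d) M f vanish = begin
  sumℤ (d ℕ.+ M) f + f (d ℕ.+ M) ≡⟨ cong₂ _+_ (sum-pad d M f vanish) (vanish (d ℕ.+ M) (ℕP.m≤n+m M d)) ⟩
  sumℤ M f + + 0                 ≡⟨ ℤP.+-identityʳ (sumℤ M f) ⟩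
  sumℤ M f                       ∎
  where open ≡-Reasoning

term : ℤ → ℤ → ℕ → ℕ → ℤ
term b c k j = coeff k j * b ^ (k ∸ 2 ℕ.* j) * c ^ j

coeff-vanish : ∀ k j → k < 2 ℕ.* j → coeff k j ≡ + 0
coeff-vanish k j k<2j = cong (λ x → + (x ℕ.* ((2 ℕ.* j) C j))) (k>n⇒nCk≡0 k<2j)

beyond-half : ∀ k j → suc (k ℕ./ 2) ≤ j → k < 2 ℕ.* j
beyond-half k j le = ℕP.<-≤-trans k<2[1+k/2] (ℕP.*-monoʳ-≤ 2 le)
  where
  k<2[1+k/2] : k < 2 ℕ.* suc (k ℕ./ 2)
  k<2[1+k/2] = subst₂ _<_ (sym (m≡m%n+[m/n]*n k 2)) (ℕP.*-comm (suc (k ℕ./ 2)) 2)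
                      (ℕP.+-monoˡ-< ((k ℕ./ 2) ℕ.* 2) (m%n<n k 2))

T-padded : ∀ b c k N → k ≤ N → T k b c ≡ sumℤ (suc N) (term b c k)
T-padded b c k N k≤N = begin
  T k b c                        ≡⟨ sum-pad (suc N ∸ M) M (term b c k) vanish ⟨
  sumℤ (suc N ∸ M ℕ.+ M) (term b c k) ≡⟨ cong (λ n → sumℤ n (term b c k)) (ℕP.m∸n+n≡m M≤N) ⟩
  sumℤ (suc N) (term b c k)      ∎
  where
  open ≡-Reasoning
  M = suc (k ℕ./ 2)
  M≤N : M ≤ suc N
  M≤N = s≤s (ℕP.≤-trans (m/n≤m k 2) k≤N)
  vanish : ∀ j → M ≤ j → term b c k j ≡ + 0
  vanish j M≤j = cong (λ a → a * b ^ (k ∸ 2 ℕ.* j) * c ^ j) (coeff-vanish k j (beyond-half k j M≤j))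

-- Where a(k,j) ≠ 0 we have 2j ≤ k, so b^(d+k-2j) = b^d · b^(k-2j) despite truncated subtraction.
coeff-lift : ∀ b k j d → coeff k j * b ^ (d ℕ.+ k ∸ 2 ℕ.* j) ≡ b ^ d * (coeff k j * b ^ (k ∸ 2 ℕ.* j))
coeff-lift b k j zero    = sym (ℤP.*-identityˡ _)
coeff-lift b k j (suc d) with 2 ℕ.* j ℕ.≤? d ℕ.+ k
... | yes 2j≤d+k = begin
  coeff k j * b ^ (suc (d ℕ.+ k) ∸ 2 ℕ.* j)    ≡⟨ cong (λ e → coeff k j * b ^ e) (ℕP.+-∸-assoc 1 2j≤d+k) ⟩
  coeff k j * (b * b ^ (d ℕ.+ k ∸ 2 ℕ.* j))    ≡⟨ swap (coeff k j) b _ ⟩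
  b * (coeff k j * b ^ (d ℕ.+ k ∸ 2 ℕ.* j))    ≡⟨ cong (b *_) (coeff-lift b k j d) ⟩
  b * (b ^ d * (coeff k j * b ^ (k ∸ 2 ℕ.* j))) ≡⟨ ℤP.*-assoc b (b ^ d) _ ⟨
  b ^ suc d * (coeff k j * b ^ (k ∸ 2 ℕ.* j))  ∎
  where open ≡-Reasoning
        swap : ∀ x y z → x * (y * z) ≡ y * (x * z)
        swap = solve-∀
... | no 2j≰d+k = begin
  coeff k j * b ^ (suc d ℕ.+ k ∸ 2 ℕ.* j)        ≡⟨ cong (_* b ^ (suc d ℕ.+ k ∸ 2 ℕ.* j)) vanishes ⟩
  + 0                                            ≡⟨ ℤP.*-zeroʳ (b ^ suc d) ⟨
  b ^ suc d * (+ 0 * b ^ (k ∸ 2 ℕ.* j))          ≡⟨ cong (λ a → b ^ suc d * (a * b ^ (k ∸ 2 ℕ.* j))) vanishes ⟨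
  b ^ suc d * (coeff k j * b ^ (k ∸ 2 ℕ.* j))    ∎
  where open ≡-Reasoning
        vanishes : coeff k j ≡ + 0
        vanishes = coeff-vanish k j (ℕP.≤-<-trans (ℕP.m≤n+m k d) (ℕP.≰⇒> 2j≰d+k))

module _ (b c : ℤ) where

  open ≡-Reasoning

  shifted-term : ℕ → ℕ → ℤ
  shifted-term m j = coeff-pred m j * b ^ (2 ℕ.+ m ∸ 2 ℕ.* j) * c ^ j

  term-rec : ∀ m j →
    (+ 2 + + m) * term b c (2 ℕ.+ m) j + (+ 1 + + m) * (b * b) * term b c m j
      ≡ (+ 3 + + 2 * + m) * b * term b c (1 ℕ.+ m) j + + 4 * (+ 1 + + m) * shifted-term m j
  term-rec m j = begin
    (+ 2 + + m) * (A₂ * B * cʲ) + (+ 1 + + m) * (b * b) * (A₀ * B₀ * cʲ)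
      ≡⟨ collect₀ (+ m) A₂ B A₀ B₀ b cʲ ⟩
    ((+ 2 + + m) * (A₂ * B) + (+ 1 + + m) * (b ^ 2 * (A₀ * B₀))) * cʲ
      ≡⟨ cong (λ u → ((+ 2 + + m) * (A₂ * B) + (+ 1 + + m) * u) * cʲ) (coeff-lift b m j 2) ⟨
    ((+ 2 + + m) * (A₂ * B) + (+ 1 + + m) * (A₀ * B)) * cʲ
      ≡⟨ factor (+ 2 + + m) (+ 1 + + m) A₂ A₀ B cʲ ⟩
    ((+ 2 + + m) * A₂ + (+ 1 + + m) * A₀) * B * cʲ
      ≡⟨ cong (λ u → u * B * cʲ) (coeff-rec m j) ⟩
    ((+ 3 + + 2 * + m) * A₁ + + 4 * (+ 1 + + m) * A₋) * B * cʲ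
      ≡⟨ factor (+ 3 + + 2 * + m) (+ 4 * (+ 1 + + m)) A₁ A₋ B cʲ ⟨
    ((+ 3 + + 2 * + m) * (A₁ * B) + + 4 * (+ 1 + + m) * (A₋ * B)) * cʲ
      ≡⟨ cong (λ u → ((+ 3 + + 2 * + m) * u + + 4 * (+ 1 + + m) * (A₋ * B)) * cʲ) (coeff-lift b (suc m) j 1) ⟩
    ((+ 3 + + 2 * + m) * (b ^ 1 * (A₁ * B₁)) + + 4 * (+ 1 + + m) * (A₋ * B)) * cʲ
      ≡⟨ collect₁ (+ 3 + + 2 * + m) (+ 4 * (+ 1 + + m)) A₁ B₁ A₋ B b cʲ ⟩
    (+ 3 + + 2 * + m) * b * (A₁ * B₁ * cʲ) + + 4 * (+ 1 + + m) * (A₋ * B * cʲ) ∎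
    where
    A₂ = coeff (2 ℕ.+ m) j
    A₁ = coeff (1 ℕ.+ m) j
    A₀ = coeff m j
    A₋ = coeff-pred m j
    B  = b ^ (2 ℕ.+ m ∸ 2 ℕ.* j)
    B₁ = b ^ (1 ℕ.+ m ∸ 2 ℕ.* j)
    B₀ = b ^ (m ∸ 2 ℕ.* j)
    cʲ = c ^ j
    collect₀ : ∀ n x y u v w z → (+ 2 + n) * (x * y * z) + (+ 1 + n) * (w * w) * (u * v * z)
                               ≡ ((+ 2 + n) * (x * y) + (+ 1 + n) * (w * (w * + 1) * (u * v))) * z
    collect₀ = solve-∀
    factor : ∀ p q x y u z → (p * (x * u) + q * (y * u)) * z ≡ (p * x + q * y) * u * z
    factor = solve-∀
    collect₁ : ∀ p q x y u v w z → (p * (w * + 1 * (x * y)) + q * (u * v)) * z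
                                 ≡ p * w * (x * y * z) + q * (u * v * z)
    collect₁ = solve-∀

  shifted-sum : ∀ m N → sumℤ (suc N) (shifted-term m) ≡ c * sumℤ N (term b c m)
  shifted-sum m N = begin
    sumℤ (suc N) (shifted-term m)                   ≡⟨ sum-shift N (shifted-term m) ⟩
    + 0 + sumℤ N (λ i → shifted-term m (suc i))     ≡⟨ ℤP.+-identityˡ _ ⟩
    sumℤ N (λ i → shifted-term m (suc i))           ≡⟨ sum-cong N (λ i _ → step i) ⟩
    sumℤ N (λ i → c * term b c m i)                 ≡⟨ sum-scale N c (term b c m) ⟨
    c * sumℤ N (term b c m)                         ∎
    where
    step : ∀ i → shifted-term m (suc i) ≡ c * term b c m i
    step i = begin
      coeff m i * b ^ (2 ℕ.+ m ∸ 2 ℕ.* suc i) * (c * c ^ i)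
        ≡⟨ cong (λ e → coeff m i * b ^ (2 ℕ.+ m ∸ e) * (c * c ^ i)) (ℕP.*-suc 2 i) ⟩
      coeff m i * b ^ (m ∸ 2 ℕ.* i) * (c * c ^ i)
        ≡⟨ swap (coeff m i * b ^ (m ∸ 2 ℕ.* i)) c (c ^ i) ⟩
      c * (coeff m i * b ^ (m ∸ 2 ℕ.* i) * c ^ i) ∎
      where swap : ∀ x y z → x * (y * z) ≡ y * (x * z)
            swap = solve-∀

  T-rec-sum : ∀ m →
    (+ 2 + + m) * T (2 ℕ.+ m) b c + (+ 1 + + m) * (b * b) * T m b c
      ≡ (+ 3 + + 2 * + m) * b * T (1 ℕ.+ m) b c + + 4 * (+ 1 + + m) * c * T m b c
  T-rec-sum m = begin
    p * T (2 ℕ.+ m) b c + q * T m b c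
      ≡⟨ cong₂ (λ u v → p * u + q * v) (T-padded b c (2 ℕ.+ m) N ℕP.≤-refl) (T-padded b c m N m≤N) ⟩
    p * sumℤ (suc N) (term b c (2 ℕ.+ m)) + q * sumℤ (suc N) (term b c m)
      ≡⟨ sum-linear (suc N) p q _ _ ⟩
    sumℤ (suc N) (λ j → p * term b c (2 ℕ.+ m) j + q * term b c m j)
      ≡⟨ sum-cong (suc N) (λ j _ → term-rec m j) ⟩
    sumℤ (suc N) (λ j → r * term b c (1 ℕ.+ m) j + s * shifted-term m j)
      ≡⟨ sum-linear (suc N) r s _ _ ⟨
    r * sumℤ (suc N) (term b c (1 ℕ.+ m)) + s * sumℤ (suc N) (shifted-term m)
      ≡⟨ cong₂ (λ u v → r * u + s * v) (sym (T-padded b c (1 ℕ.+ m) N (ℕP.n≤1+n _))) (shifted-sum m N) ⟩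
    r * T (1 ℕ.+ m) b c + s * (c * sumℤ N (term b c m))
      ≡⟨ cong (λ u → r * T (1 ℕ.+ m) b c + s * (c * u)) (T-padded b c m (suc m) (ℕP.n≤1+n m)) ⟨
    r * T (1 ℕ.+ m) b c + s * (c * T m b c)
      ≡⟨ cong (_+_ (r * T (1 ℕ.+ m) b c)) (ℤP.*-assoc s c (T m b c)) ⟨
    r * T (1 ℕ.+ m) b c + s * c * T m b c ∎
    where
    N = 2 ℕ.+ m
    m≤N : m ≤ N
    m≤N = ℕP.≤-trans (ℕP.n≤1+n m) (ℕP.n≤1+n (suc m))
    p = + 2 + + m
    q = (+ 1 + + m) * (b * b)
    r = (+ 3 + + 2 * + m) * b
    s = + 4 * (+ 1 + + m)

  T-one : T 1 b c ≡ b
  T-one = evaluate b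
    where evaluate : ∀ x → + 0 + + 1 * (x * + 1) * + 1 ≡ x
          evaluate = solve-∀

  -- The recurrence in the form used below, valid for every n (for n = 0 both sides are b):
  -- (n+1) T_{n+1} + n (b² - 4c) T_{n-1} = (2n+1) b T_n.
  T-rec : ∀ n → (+ 1 + + n) * T (suc n) b c + + n * (b * b - + 4 * c) * T (n ∸ 1) b c
                  ≡ (+ 1 + + 2 * + n) * b * T n b c
  T-rec zero    = begin
    (+ 1 + + 0) * T 1 b c + + 0 * (b * b - + 4 * c) * + 1
      ≡⟨ cong (λ u → (+ 1 + + 0) * u + + 0 * (b * b - + 4 * c) * + 1) T-one ⟩
    (+ 1 + + 0) * b + + 0 * (b * b - + 4 * c) * + 1
      ≡⟨ base b (b * b - + 4 * c) ⟩
    (+ 1 + + 2 * + 0) * b * + 1 ∎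
    where base : ∀ x q → (+ 1 + + 0) * x + + 0 * q * + 1 ≡ (+ 1 + + 2 * + 0) * x * + 1
          base = solve-∀
  T-rec (suc m) = begin
    (+ 2 + + m) * T₂ + (+ 1 + + m) * (b * b - + 4 * c) * T₀
      ≡⟨ expand (+ m) b c T₂ T₀ ⟩
    ((+ 2 + + m) * T₂ + (+ 1 + + m) * (b * b) * T₀) - + 4 * (+ 1 + + m) * c * T₀
      ≡⟨ cong (_- + 4 * (+ 1 + + m) * c * T₀) (T-rec-sum m) ⟩
    ((+ 3 + + 2 * + m) * b * T₁ + + 4 * (+ 1 + + m) * c * T₀) - + 4 * (+ 1 + + m) * c * T₀
      ≡⟨ cancel (+ m) b c T₁ T₀ ⟩
    (+ 1 + + 2 * (+ 1 + + m)) * b * T₁ ∎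
    where
    T₂ = T (2 ℕ.+ m) b c
    T₁ = T (1 ℕ.+ m) b c
    T₀ = T m b c
    expand : ∀ n x y u v → (+ 2 + n) * u + (+ 1 + n) * (x * x - + 4 * y) * v
                         ≡ ((+ 2 + n) * u + (+ 1 + n) * (x * x) * v) - + 4 * (+ 1 + n) * y * v
    expand = solve-∀
    cancel : ∀ n x y u v → ((+ 3 + + 2 * n) * x * u + + 4 * (+ 1 + n) * y * v) - + 4 * (+ 1 + n) * y * v
                         ≡ (+ 1 + + 2 * (+ 1 + n)) * x * u
    cancel = solve-∀

isolateˡ : ∀ {x y z : ℤ} → x + y ≡ z → x ≡ z - y
isolateˡ {x} {y} refl = sym (cancel x y)
  where cancel : ∀ x y → x + y - y ≡ x
        cancel = solve-∀

isolateʳ : ∀ {x y z : ℤ} → x + y ≡ z → y ≡ z - x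
isolateʳ {x} {y} refl = sym (cancel x y)
  where cancel : ∀ x y → x + y - x ≡ y
        cancel = solve-∀

horner : ℤ → (ℕ → ℤ) → ℕ → ℤ
horner d f n = sumℤ n (λ k → f k * d ^ (n ∸ 1 ∸ k))

horner-suc : ∀ d f n → horner d f (suc n) ≡ d * horner d f n + f n
horner-suc d f n = cong₂ _+_ (trans (sum-cong n raise) (sym (sum-scale n d _))) constant
  where
  open ≡-Reasoning
  raise : ∀ k → k < n → f k * d ^ (n ∸ k) ≡ d * (f k * d ^ (n ∸ 1 ∸ k))
  raise k (s≤s k≤n-1) = begin
    f k * d ^ (n ∸ k)                 ≡⟨ cong (λ e → f k * d ^ e) (ℕP.+-∸-assoc 1 k≤n-1) ⟩
    f k * (d * d ^ (n ∸ 1 ∸ k))       ≡⟨ swap (f k) d (d ^ (n ∸ 1 ∸ k)) ⟩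
    d * (f k * d ^ (n ∸ 1 ∸ k))       ∎
    where swap : ∀ x y z → x * (y * z) ≡ y * (x * z)
          swap = solve-∀
  constant : f n * d ^ (n ∸ n) ≡ f n
  constant = trans (cong (λ e → f n * d ^ e) (ℕP.n∸n≡0 n)) (ℤP.*-identityʳ (f n))

-- The integer form of the theorem.  Throughout, t_k = T_k(b,c²) and d = b - 2c, so that
-- the T-recurrence has discriminant b² - 4c² = (b - 2c)(b + 2c).
module Horner-identities (b c : ℤ) where

  open ≡-Reasoning

  t : ℕ → ℤ
  t k = T k b (c ^ 2)

  d : ℤ
  d = b - + 2 * c

  kt : ℕ → ℤ
  kt k = + k * t k

  S₀ S₁ : ℕ → ℤ
  S₀ = horner d t
  S₁ = horner d kt

  G : ℕ → ℤ
  G n = (b + + 4 * c) * t n - (b + + 2 * c) ^ 2 * t (n ∸ 1)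

  S₀-closed : ∀ n → + 2 * c * d * S₀ n ≡ ((+ 1 + + n) * b + + 2 * + n * c) * t n - (+ 1 + + n) * t (suc n)
  S₀-closed zero    = begin
    + 2 * c * d * + 0
      ≡⟨ base b c ⟩
    ((+ 1 + + 0) * b + + 2 * + 0 * c) * + 1 - (+ 1 + + 0) * b
      ≡⟨ cong (λ u → ((+ 1 + + 0) * b + + 2 * + 0 * c) * + 1 - (+ 1 + + 0) * u) (T-one b (c ^ 2)) ⟨
    ((+ 1 + + 0) * b + + 2 * + 0 * c) * + 1 - (+ 1 + + 0) * t 1 ∎
    where base : ∀ x y → + 2 * y * (x - + 2 * y) * + 0 ≡ ((+ 1 + + 0) * x + + 2 * + 0 * y) * + 1 - (+ 1 + + 0) * x
          base = solve-∀
  S₀-closed (suc n) = begin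
    + 2 * c * d * S₀ (suc n)
      ≡⟨ cong (+ 2 * c * d *_) (horner-suc d t n) ⟩
    + 2 * c * d * (d * S₀ n + t n)
      ≡⟨ expand (+ 2 * c * d) d (S₀ n) (t n) ⟩
    d * (+ 2 * c * d * S₀ n) + + 2 * c * d * t n
      ≡⟨ cong (λ u → d * u + + 2 * c * d * t n) (S₀-closed n) ⟩
    d * (((+ 1 + + n) * b + + 2 * + n * c) * t n - (+ 1 + + n) * t (suc n)) + + 2 * c * d * t n
      ≡⟨ regroup (+ n) b c (t n) (t (suc n)) ⟩
    X - ((+ 1 + + 2 * (+ 1 + + n)) * b * t (suc n) - (+ 1 + + n) * (b * b - + 4 * c ^ 2) * t n)
      ≡⟨ cong (X -_) (isolateˡ (T-rec b (c ^ 2) (suc n))) ⟨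
    X - (+ 2 + + n) * t (suc (suc n)) ∎
    where
    X = ((+ 2 + + n) * b + + 2 * (+ 1 + + n) * c) * t (suc n)
    expand : ∀ k x s u → k * (x * s + u) ≡ x * (k * s) + k * u
    expand = solve-∀
    -- (c ^ 2 appears unfolded, as y * (y * + 1))
    regroup : ∀ n x y u v →
      (x - + 2 * y) * (((+ 1 + n) * x + + 2 * n * y) * u - (+ 1 + n) * v) + + 2 * y * (x - + 2 * y) * u
        ≡ ((+ 2 + n) * x + + 2 * (+ 1 + n) * y) * v
          - ((+ 1 + + 2 * (+ 1 + n)) * x * v - (+ 1 + n) * (x * x - + 4 * (y * (y * + 1))) * u)
    regroup = solve-∀

  scaled-identity : ∀ n → + 4 * (c * c) * (+ 3 * S₁ n - + n * S₀ n) ≡ + n * G n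
  scaled-identity zero    = ℤP.*-zeroʳ (+ 4 * (c * c))
  scaled-identity (suc n) = begin
    K * (+ 3 * S₁ (suc n) - (+ 1 + + n) * S₀ (suc n))
      ≡⟨ cong₂ (λ u v → K * (+ 3 * u - (+ 1 + + n) * v)) (horner-suc d kt n) (horner-suc d t n) ⟩
    K * (+ 3 * (d * S₁ n + + n * t n) - (+ 1 + + n) * (d * S₀ n + t n))
      ≡⟨ regroup₁ (+ n) b c (S₀ n) (S₁ n) (t n) ⟩
    d * (K * (+ 3 * S₁ n - + n * S₀ n)) - + 2 * c * (+ 2 * c * d * S₀ n) + K * (+ 2 * + n - + 1) * t n
      ≡⟨ cong₂ (λ u v → d * u - + 2 * c * v + K * (+ 2 * + n - + 1) * t n) (scaled-identity n) (S₀-closed n) ⟩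
    d * (+ n * G n) - + 2 * c * (((+ 1 + + n) * b + + 2 * + n * c) * t n - (+ 1 + + n) * t (suc n))
      + K * (+ 2 * + n - + 1) * t n
      ≡⟨ regroup₂ (+ n) b c (t n) (t (suc n)) (t (n ∸ 1)) ⟩
    Y + + 2 * c * A - (b + + 2 * c) * (+ n * (b * b - + 4 * c ^ 2) * t (n ∸ 1))
      ≡⟨ cong (λ u → Y + + 2 * c * A - (b + + 2 * c) * u) (isolateʳ (T-rec b (c ^ 2) n)) ⟩
    Y + + 2 * c * A - (b + + 2 * c) * ((+ 1 + + 2 * + n) * b * t n - A)
      ≡⟨ regroup₃ (+ n) b c (t n) (t (suc n)) ⟩
    (+ 1 + + n) * G (suc n) ∎
    where
    K = + 4 * (c * c)
    A = (+ 1 + + n) * t (suc n)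
    Y = (d * + n * (b + + 4 * c) - + 2 * c * ((+ 1 + + n) * b + + 2 * + n * c) + K * (+ 2 * + n - + 1)) * t n
    regroup₁ : ∀ n x y s₀ s₁ u →
      + 4 * (y * y) * (+ 3 * ((x - + 2 * y) * s₁ + n * u) - (+ 1 + n) * ((x - + 2 * y) * s₀ + u))
        ≡ (x - + 2 * y) * (+ 4 * (y * y) * (+ 3 * s₁ - n * s₀)) - + 2 * y * (+ 2 * y * (x - + 2 * y) * s₀)
          + + 4 * (y * y) * (+ 2 * n - + 1) * u
    regroup₁ = solve-∀
    -- ((b + 2c) ^ 2 and c ^ 2 appear unfolded, as z * (z * + 1))
    regroup₂ : ∀ n x y u v w →
      (x - + 2 * y) * (n * ((x + + 4 * y) * u - (x + + 2 * y) * ((x + + 2 * y) * + 1) * w))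
        - + 2 * y * (((+ 1 + n) * x + + 2 * n * y) * u - (+ 1 + n) * v) + + 4 * (y * y) * (+ 2 * n - + 1) * u
        ≡ ((x - + 2 * y) * n * (x + + 4 * y) - + 2 * y * ((+ 1 + n) * x + + 2 * n * y) + + 4 * (y * y) * (+ 2 * n - + 1)) * u
          + + 2 * y * ((+ 1 + n) * v) - (x + + 2 * y) * (n * (x * x - + 4 * (y * (y * + 1))) * w)
    regroup₂ = solve-∀
    -- ((b + 2c) ^ 2 appears unfolded)
    regroup₃ : ∀ n x y u v →
      ((x - + 2 * y) * n * (x + + 4 * y) - + 2 * y * ((+ 1 + n) * x + + 2 * n * y) + + 4 * (y * y) * (+ 2 * n - + 1)) * u
        + + 2 * y * ((+ 1 + n) * v) - (x + + 2 * y) * ((+ 1 + + 2 * n) * x * u - (+ 1 + n) * v)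
        ≡ (+ 1 + n) * ((x + + 4 * y) * v - (x + + 2 * y) * ((x + + 2 * y) * + 1) * u)
    regroup₃ = solve-∀

toℚᵘ-/ : ∀ i n → ℚ.toℚᵘ (ℚ._/_ i (suc n)) ℚᵘ.≃ mkℚᵘ i n
toℚᵘ-/ i n = ℚP.toℚᵘ-fromℚᵘ (mkℚᵘ i n)

cast-+ : ∀ x y → ⟦ x + y ⟧ ≡ ⟦ x ⟧ ℚ.+ ⟦ y ⟧
cast-+ x y = ℚP.toℚᵘ-injective (begin
  ℚ.toℚᵘ ⟦ x + y ⟧                  ≈⟨ toℚᵘ-/ (x + y) 0 ⟩
  mkℚᵘ (x + y) 0                    ≈⟨ *≡* (add x y) ⟩
  mkℚᵘ x 0 ℚᵘ.+ mkℚᵘ y 0            ≈⟨ ℚᵘP.+-cong (toℚᵘ-/ x 0) (toℚᵘ-/ y 0) ⟨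
  ℚ.toℚᵘ ⟦ x ⟧ ℚᵘ.+ ℚ.toℚᵘ ⟦ y ⟧    ≈⟨ ℚP.toℚᵘ-homo-+ ⟦ x ⟧ ⟦ y ⟧ ⟨
  ℚ.toℚᵘ (⟦ x ⟧ ℚ.+ ⟦ y ⟧)          ∎)
  where
  open ℚᵘP.≃-Reasoning
  add : ∀ x y → (x + y) * + 1 ≡ (x * + 1 + y * + 1) * + 1
  add = solve-∀

sumℚ-cast : ∀ N (f : ℕ → ℤ) → sumℚ N (λ k → ⟦ f k ⟧) ≡ ⟦ sumℤ N f ⟧
sumℚ-cast zero    f = refl
sumℚ-cast (suc N) f = trans (cong (ℚ._+ ⟦ f N ⟧) (sumℚ-cast N f)) (sym (cast-+ (sumℤ N f) (f N)))

scaled-difference : ∀ (p x y z : ℤ) n D .{{_ : ℕ.NonZero n}} .{{_ : ℕ.NonZero D}} →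
  + D * (p * x - + n * y) ≡ + n * z → ℚ._/_ p n ℚ.* ⟦ x ⟧ ℚ.- ⟦ y ⟧ ≡ ℚ._/_ z D
scaled-difference p x y z (suc n) (suc D) eq = ℚP.toℚᵘ-injective (begin
  ℚ.toℚᵘ (P ℚ.* ⟦ x ⟧ ℚ.- ⟦ y ⟧)
    ≈⟨ ℚP.toℚᵘ-homo-+ (P ℚ.* ⟦ x ⟧) (ℚ.- ⟦ y ⟧) ⟩
  ℚ.toℚᵘ (P ℚ.* ⟦ x ⟧) ℚᵘ.+ ℚ.toℚᵘ (ℚ.- ⟦ y ⟧)
    ≈⟨ ℚᵘP.+-cong (ℚP.toℚᵘ-homo-* P ⟦ x ⟧) (ℚP.toℚᵘ-homo‿- ⟦ y ⟧) ⟩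
  ℚ.toℚᵘ P ℚᵘ.* ℚ.toℚᵘ ⟦ x ⟧ ℚᵘ.- ℚ.toℚᵘ ⟦ y ⟧
    ≈⟨ ℚᵘP.+-cong (ℚᵘP.*-cong (toℚᵘ-/ p n) (toℚᵘ-/ x 0)) (ℚᵘP.-‿cong (toℚᵘ-/ y 0)) ⟩
  mkℚᵘ p n ℚᵘ.* mkℚᵘ x 0 ℚᵘ.- mkℚᵘ y 0
    ≈⟨ *≡* cross ⟩
  mkℚᵘ z D
    ≈⟨ toℚᵘ-/ z D ⟨
  ℚ.toℚᵘ (ℚ._/_ z (suc D)) ∎)
  where
  open ℚᵘP.≃-Reasoning
  P = ℚ._/_ p (suc n)
  rearrange : ∀ p x y n d → (p * x * + 1 + (ℤ.- y) * n) * d ≡ d * (p * x - n * y)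
  rearrange = solve-∀
  cross : (p * x * + 1 + (ℤ.- y) * + suc (n ℕ.* 1)) * + suc D ≡ z * + suc (n ℕ.* 1 ℕ.* 1)
  cross rewrite ℕP.*-identityʳ n | ℕP.*-identityʳ n =
    trans (rearrange p x y (+ suc n) (+ suc D)) (trans eq (ℤP.*-comm (+ suc n) z))

denominator : ∀ c → + (4 ℕ.* ℤ.∣ c ∣ ℕ.* ℤ.∣ c ∣) ≡ + 4 * (c * c)
denominator c = begin
  + (4 ℕ.* ∣c∣ ℕ.* ∣c∣)     ≡⟨ ℤP.pos-* (4 ℕ.* ∣c∣) ∣c∣ ⟩
  + (4 ℕ.* ∣c∣) * + ∣c∣     ≡⟨ cong (_* + ∣c∣) (ℤP.pos-* 4 ∣c∣) ⟩
  + 4 * + ∣c∣ * + ∣c∣       ≡⟨ ℤP.*-assoc (+ 4) (+ ∣c∣) (+ ∣c∣) ⟩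
  + 4 * (+ ∣c∣ * + ∣c∣)     ≡⟨ cong (+ 4 *_) (abs-square c) ⟩
  + 4 * (c * c)             ∎
  where
  open ≡-Reasoning
  ∣c∣ = ℤ.∣ c ∣
  abs-square : ∀ c → + ℤ.∣ c ∣ * + ℤ.∣ c ∣ ≡ c * c
  abs-square (+ n)     = refl
  abs-square ℤ.-[1+ n ] = refl

lemma3p2 : (b c : ℤ) → .{{_ : ℤ.NonZero c}} → (n : ℕ) → .{{_ : ℕ.NonZero n}} →
    (ℚ._/_ (+ 3) n) ℚ.* sumℚ n (λ k → ⟦ + k * T k b (c ^ 2) * (b - + 2 * c) ^ (n ℕ.∸ 1 ℕ.∸ k) ⟧)
      ℚ.- sumℚ n (λ k → ⟦ T k b (c ^ 2) * (b - + 2 * c) ^ (n ℕ.∸ 1 ℕ.∸ k) ⟧)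
    ≡ ((b + + 4 * c) * T n b (c ^ 2) - (b + + 2 * c) ^ 2 * T (n ℕ.∸ 1) b (c ^ 2)) /4c²[ c ]
lemma3p2 b c n {{n≢0}} = begin
  ℚ._/_ (+ 3) n ℚ.* sumℚ n (λ k → ⟦ kt k * d ^ (n ∸ 1 ∸ k) ⟧) ℚ.- sumℚ n (λ k → ⟦ t k * d ^ (n ∸ 1 ∸ k) ⟧)
    ≡⟨ cong₂ (λ u v → ℚ._/_ (+ 3) n ℚ.* u ℚ.- v) (sumℚ-cast n (λ k → kt k * d ^ (n ∸ 1 ∸ k)))
                                                  (sumℚ-cast n (λ k → t k * d ^ (n ∸ 1 ∸ k))) ⟩
  ℚ._/_ (+ 3) n ℚ.* ⟦ S₁ n ⟧ ℚ.- ⟦ S₀ n ⟧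
    ≡⟨ scaled-difference (+ 3) (S₁ n) (S₀ n) (G n) n D {{n≢0}} {{D≢0}}
         (trans (cong (_* (+ 3 * S₁ n - + n * S₀ n)) (denominator c)) (scaled-identity n)) ⟩
  G n /4c²[ c ] ∎
  where
  open ≡-Reasoning
  open Horner-identities b c
  D = 4 ℕ.* ℤ.∣ c ∣ ℕ.* ℤ.∣ c ∣
  D≢0 : ℕ.NonZero D
  D≢0 = ℕP.m*n≢0 (4 ℕ.* ℤ.∣ c ∣) ℤ.∣ c ∣ {{ℕP.m*n≢0 4 ℤ.∣ c ∣}}
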